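{- There exists a finite set $\Sigma$ of Datalog$^\exists$ rules that is Warded Datalog$^\pm$ but not Shy Datalog$^\exists$.
   Context: A Datalog$^\exists$ rule is a formula $\forall \bar x\forall \bar y\,(\varphi(\bar x,\bar y)\to\exists \bar z\,\psi(\bar x,\bar z))$ with $\varphi$ (body) and $\psi$ (head) conjunctions of relational atoms whose terms are constants or variables; variables of $\bar z$ are $\exists$-variables, the others $\forall$-variables. A position $p[i]$ is the $i$-th argument of predicate $p$. Given a set $\Sigma$ of rules: $p[i]$ is affected if (i) some rule of $\Sigma$ has an $\exists$-variable at position $p[i]$ in its head, or (ii) some rule of $\Sigma$ has a $\forall$-variable occurring in its body only in affected positions and occurring at $p[i]$ in its head (least set closed under these). For an $\exists$-variable $y$ of $\Sigma$, $p[i]$ is invaded by $y$ if there is a rule $\rho\in\Sigma$ with head atom $p(t_1,\dots,t_k)$ such that either $t_i=y$, or $t_i$ is a $\forall$-variable occurring in the body of $\rho$ only in positions invaded by $y$ (least set closed under these). A variable $x$ of a conjunction of atoms is attacked by $y$ in that conjunction if $x$ occurs in it only in positions invaded by $y$; $x$ is protected if it is attacked by no variable. $\Sigma$ is Shy Datalog$^\exists$ if for every rule $\sigma\in\Sigma$: (S1) every variable occurring in more than one body atom of $\sigma$ is protected in the body of $\sigma$; (S2) if two distinct $\forall$-variables are not protected in the body of $\sigma$ but both occur in the head of $\sigma$ and in two different body atoms, then they are not attacked by the same variable. A $\forall$-variable $x$ of a rule $\rho$ is harmful (w.r.t. $\rho$) if it appears in $\rho$'s body only in affected positions, otherwise harmless;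 a harmful variable occurring in the head is dangerous. $\Sigma$ is Warded Datalog$^\pm$ if for every rule $\sigma\in\Sigma$: (W1) all dangerous variables of $\sigma$ appear in a single body atom, called the ward; (W2) the ward shares only harmless variables with the other body atoms. -}

module Defs where

open import Data.Nat using (ℕ; zero; suc)
open import Data.List using (List; []; _∷_; length)
open import Data.List.Membership.Propositional using (_∈_)
open import Data.Maybe using (Maybe; just; nothing)
open import Data.Product using (Σ; ∃; _×_; _,_)
open import Data.Sum using (_⊎_)
open import Relation.Binary.PropositionalEquality using (_≡_; _≢_)
open import Relation.Nullary using (¬_)

data Term : Set where
  const : ℕ → Term
  var   : ℕ → Term

record Atom : Set where
  constructor atom
  field
    pred : ℕ
    args : List Term
open Atom public

Conj : Set
Conj = List Atom

-- A rule  ∀x̄∀ȳ (body → ∃z̄ head).  The ∀-variables are the variables of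
-- the body; the ∃-variables are the head variables not occurring in the body.
record Rule : Set where
  constructor _⇒_
  field
    body : Conj
    head : Conj
open Rule public

-- positions p[i] : predicate symbol p and argument index i (0-based)
Position : Set
Position = ℕ × ℕ

nth : {A : Set} → List A → ℕ → Maybe A
nth []       _       = nothing
nth (x ∷ xs) zero    = just x
nth (x ∷ xs) (suc i) = nth xs i

OccAtomAt : ℕ → Atom → ℕ → Set
OccAtomAt x a i = nth (args a) i ≡ just (var x)

OccAtom : ℕ → Atom → Set
OccAtom x a = ∃ λ i → OccAtomAt x a i

OccursAt : ℕ → Position → Conj → Set
OccursAt x (p , i) C = ∃ λ a → a ∈ C × pred a ≡ p × OccAtomAt x a i

OccursIn : ℕ → Conj → Set
OccursIn x C = ∃ λ a → a ∈ C × OccAtom x a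

OnlyIn : ℕ → Conj → (Position → Set) → Set
OnlyIn x C P = ∀ pos → OccursAt x pos C → P pos

IsUVar : Rule → ℕ → Set
IsUVar ρ x = OccursIn x (body ρ)

IsEVar : Rule → ℕ → Set
IsEVar ρ x = OccursIn x (head ρ) × ¬ OccursIn x (body ρ)

Atoms : List Rule → List Atom
Atoms [] = []
Atoms (ρ ∷ ρs) = body ρ Data.List.++ head ρ Data.List.++ Atoms ρs

WellFormed : List Rule → Set
WellFormed Σ' =
  (∀ ρ → ρ ∈ Σ' → (∃ λ a → a ∈ body ρ) × (∃ λ a → a ∈ head ρ)) ×
  (∀ a b → a ∈ Atoms Σ' → b ∈ Atoms Σ' → pred a ≡ pred b →
     length (args a) ≡ length (args b))

data Affected (Σ' : List Rule) : Position → Set where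
  aff-ex   : ∀ {ρ y pos} → ρ ∈ Σ' → IsEVar ρ y → OccursAt y pos (head ρ) →
             Affected Σ' pos
  aff-prop : ∀ {ρ x pos} → ρ ∈ Σ' → IsUVar ρ x →
             (∀ q → OccursAt x q (body ρ) → Affected Σ' q) →
             OccursAt x pos (head ρ) → Affected Σ' pos

-- Invaded positions.  Variables are local to rules, so an ∃-variable of Σ
-- is a pair (ρy , y) with ρy ∈ Σ and y an ∃-variable of ρy.

ExVar : List Rule → Set
ExVar Σ' = ∃ λ ρy → ∃ λ y → ρy ∈ Σ' × IsEVar ρy y

data Invaded (Σ' : List Rule) (ρy : Rule) (y : ℕ) : Position → Set where
  inv-ex   : ∀ {pos} → OccursAt y pos (head ρy) → Invaded Σ' ρy y pos
  inv-prop : ∀ {ρ x pos} → ρ ∈ Σ' → IsUVar ρ x →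
             (∀ q → OccursAt x q (body ρ) → Invaded Σ' ρy y q) →
             OccursAt x pos (head ρ) → Invaded Σ' ρy y pos

Attacked : (Σ' : List Rule) → Conj → ℕ → Rule → ℕ → Set
Attacked Σ' C x ρy y = OccursIn x C × OnlyIn x C (Invaded Σ' ρy y)

Protected : List Rule → Conj → ℕ → Set
Protected Σ' C x =
  ∀ ρy y → ρy ∈ Σ' → IsEVar ρy y → ¬ Attacked Σ' C x ρy y

S1 : List Rule → Rule → Set
S1 Σ' σ = ∀ x a b → a ∈ body σ → b ∈ body σ → a ≢ b →
          OccAtom x a → OccAtom x b → Protected Σ' (body σ) x

S2 : List Rule → Rule → Set
S2 Σ' σ = ∀ x₁ x₂ → x₁ ≢ x₂ → IsUVar σ x₁ → IsUVar σ x₂ →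
          ¬ Protected Σ' (body σ) x₁ → ¬ Protected Σ' (body σ) x₂ →
          OccursIn x₁ (head σ) → OccursIn x₂ (head σ) →
          (∃ λ a₁ → ∃ λ a₂ → a₁ ∈ body σ × a₂ ∈ body σ × a₁ ≢ a₂ ×
             OccAtom x₁ a₁ × OccAtom x₂ a₂) →
          ¬ (∃ λ ρy → ∃ λ y → ρy ∈ Σ' × IsEVar ρy y ×
               Attacked Σ' (body σ) x₁ ρy y × Attacked Σ' (body σ) x₂ ρy y)

Shy : List Rule → Set
Shy Σ' = ∀ σ → σ ∈ Σ' → S1 Σ' σ × S2 Σ' σ

Harmful : List Rule → Rule → ℕ → Set
Harmful Σ' ρ x = IsUVar ρ x × OnlyIn x (body ρ) (Affected Σ')

Dangerous : List Rule → Rule → ℕ → Set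
Dangerous Σ' ρ x = Harmful Σ' ρ x × OccursIn x (head ρ)

IsWard : List Rule → Rule → Atom → Set
IsWard Σ' σ w =
  w ∈ body σ ×
  (∀ x → Dangerous Σ' σ x → OccAtom x w) ×
  (∀ a x → a ∈ body σ → a ≢ w → OccAtom x w → OccAtom x a → ¬ Harmful Σ' σ x)

WardedRule : List Rule → Rule → Set
WardedRule Σ' σ = (∃ λ x → Dangerous Σ' σ x) → ∃ λ w → IsWard Σ' σ w

Warded : List Rule → Set
Warded Σ' = ∀ σ → σ ∈ Σ' → WardedRule Σ' σ

{-# OPTIONS --safe #-}
module Submission where

open import Defs
open import Data.Nat using (ℕ; zero; suc)
open import Data.List using (List; []; _∷_; length)
open import Data.List.Relation.Unary.All using (All; []; _∷_) renaming (lookup to lookupAll)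
open import Data.List.Relation.Unary.Any using (here; there)
open import Data.List.Membership.Propositional using (_∈_)
open import Data.Empty using (⊥-elim)
open import Data.Product using (∃; _×_; _,_; proj₁)
open import Relation.Nullary using (¬_)
open import Relation.Binary.PropositionalEquality using (_≡_; _≢_; refl; sym; trans)

-- The witness is the single rule  q(x), r(x) → ∃z q(z), r(z).  Its only
-- head variable is existential, so it has no dangerous variables and is
-- trivially warded; but the join variable x sits only in q[0] and r[0],
-- which are invaded by z, so x is attacked and (S1) fails.

uniformArity⇒consistentArity : ∀ {Σ' n} → All (λ a → length (args a) ≡ n) (Atoms Σ') →
  ∀ a b → a ∈ Atoms Σ' → b ∈ Atoms Σ' → pred a ≡ pred b → length (args a) ≡ length (args b)
uniformArity⇒consistentArity arities a b a∈ b∈ _ =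
  trans (lookupAll arities a∈) (sym (lookupAll arities b∈))

noDangerous⇒Warded : ∀ {Σ'} → (∀ σ → σ ∈ Σ' → ∀ v → ¬ Dangerous Σ' σ v) → Warded Σ'
noDangerous⇒Warded noDangerous σ σ∈Σ (v , dangerous) = ⊥-elim (noDangerous σ σ∈Σ v dangerous)

attackedJoin⇒¬Shy : ∀ {Σ' σ v a b ρy y} → σ ∈ Σ' →
  a ∈ body σ → b ∈ body σ → a ≢ b → OccAtom v a → OccAtom v b →
  ρy ∈ Σ' → IsEVar ρy y → Attacked Σ' (body σ) v ρy y → ¬ Shy Σ'
attackedJoin⇒¬Shy σ∈Σ a∈ b∈ a≢b va vb ρy∈Σ y-ex attacked shy =
  proj₁ (shy _ σ∈Σ) _ _ _ a∈ b∈ a≢b va vb _ _ ρy∈Σ y-ex attacked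

unary : ℕ → ℕ → Atom
unary p v = atom p (var v ∷ [])

unaryOcc : ∀ p v {w} → OccAtom w (unary p v) → w ≡ v
unaryOcc _ _ (zero , refl) = refl
unaryOcc _ _ (suc _ , ())

q r : ℕ → Atom
q = unary 0
r = unary 1

x z : ℕ
x = 0
z = 1

joinRule : Rule
joinRule = (q x ∷ r x ∷ []) ⇒ (q z ∷ r z ∷ [])

Σ₀ : List Rule
Σ₀ = joinRule ∷ []

bodyVar≡x : ∀ {v} → OccursIn v (body joinRule) → v ≡ x
bodyVar≡x (_ , here refl , occ)         = unaryOcc 0 x occ
bodyVar≡x (_ , there (here refl) , occ) = unaryOcc 1 x occ
bodyVar≡x (_ , there (there ()) , _)

headVar≡z : ∀ {v} → OccursIn v (head joinRule) → v ≡ z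
headVar≡z (_ , here refl , occ)         = unaryOcc 0 z occ
headVar≡z (_ , there (here refl) , occ) = unaryOcc 1 z occ
headVar≡z (_ , there (there ()) , _)

z∉body : ¬ OccursIn z (body joinRule)
z∉body occ with bodyVar≡x occ
... | ()

z-existential : IsEVar joinRule z
z-existential = (q z , here refl , zero , refl) , z∉body

joinRule-noDangerous : ∀ v → ¬ Dangerous Σ₀ joinRule v
joinRule-noDangerous v ((inBody , _) , inHead) with trans (sym (bodyVar≡x inBody)) (headVar≡z inHead)
... | ()

x-attackedBy-z : Attacked Σ₀ (body joinRule) x joinRule z
x-attackedBy-z = (q x , here refl , zero , refl) , onlyInvaded
  where
  onlyInvaded : OnlyIn x (body joinRule) (Invaded Σ₀ joinRule z)
  onlyInvaded (_ , zero)  (_ , here refl , refl , refl)         = inv-ex (q z , here refl , refl , refl)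
  onlyInvaded (_ , suc _) (_ , here refl , refl , ())
  onlyInvaded (_ , zero)  (_ , there (here refl) , refl , refl) = inv-ex (r z , there (here refl) , refl , refl)
  onlyInvaded (_ , suc _) (_ , there (here refl) , refl , ())
  onlyInvaded _           (_ , there (there ()) , _)

Σ₀-wellFormed : WellFormed Σ₀
Σ₀-wellFormed =
  (λ { _ (here refl) → (q x , here refl) , (q z , here refl) }) ,
  uniformArity⇒consistentArity {Σ₀} {1} (refl ∷ refl ∷ refl ∷ refl ∷ [])

q≢r : ∀ {v w} → q v ≢ r w
q≢r ()

proposition2 : ∃ λ (Σ' : List Rule) → WellFormed Σ' × Warded Σ' × ¬ Shy Σ'
proposition2 =
  Σ₀ ,
  Σ₀-wellFormed ,
  noDangerous⇒Warded (λ { _ (here refl) → joinRule-noDangerous }) ,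
  attackedJoin⇒¬Shy (here refl) (here refl) (there (here refl)) q≢r
    (zero , refl) (zero , refl) (here refl) z-existential x-attackedBy-z
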